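{- Let $p$ be an odd prime, $q=p^e$ with $e\ge 1$, and $k$ an integer with $1\le k\le e$. Then $F_{p^k}(1,x)$ is a permutation polynomial of $\mathbb{F}_q$ if and only if $\gcd\!\left(\frac{p^k-1}{2},\,q-1\right)=1$.
   Context: For an integer $n\ge 1$, the $n$-th reversed Dickson polynomial of the third kind is $F_n(a,x)=\sum_{i=0}^{\lfloor n/2\rfloor}\frac{n-2i}{n-i}\binom{n-i}{i}(-x)^i a^{n-2i}$, where the coefficients $\frac{n-2i}{n-i}\binom{n-i}{i}=\binom{n-i}{i}-\binom{n-i-1}{i-1}$ (with $\binom{m}{ -1}=0$) are integers, read in $\mathbb{F}_q$. A polynomial $f\in\mathbb{F}_q[x]$ is a permutation polynomial of $\mathbb{F}_q$ if $c\mapsto f(c)$ is a bijection of $\mathbb{F}_q$. -}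

module Defs where

open import Level using (Level; _⊔_) renaming (suc to lsuc)
open import Data.Nat using (ℕ; zero; suc; _∸_; _/_) renaming (_*_ to _*ℕ_)
open import Data.Nat.Combinatorics using (_C_)
open import Data.Integer using (ℤ; +_; -[1+_]) renaming (_-_ to _-ℤ_)
open import Data.Fin using (Fin)
open import Data.List using (List; upTo; map; foldr)
open import Data.Product using (Σ)
open import Algebra.Bundles using (CommutativeRing)
open import Relation.Binary.PropositionalEquality using (_≡_)
import Relation.Binary.PropositionalEquality as ≡
open import Function.Bundles using (Inverse)
open import Function.Definitions using (Bijective)
open import Relation.Nullary using (¬_)

record FiniteField (q : ℕ) (c ℓ : Level) : Set (lsuc (c ⊔ ℓ)) where
  field
    commRing : CommutativeRing c ℓ
  open CommutativeRing commRing public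
  field
    0≉1     : ¬ (0# ≈ 1#)
    inverse : ∀ x → ¬ (x ≈ 0#) → Σ Carrier (λ y → x * y ≈ 1#)
    enum    : Inverse (≡.setoid (Fin q)) setoid

module _ {q : ℕ} {c ℓ : Level} (K : FiniteField q c ℓ) where
  open FiniteField K

  natK : ℕ → Carrier
  natK zero    = 0#
  natK (suc n) = 1# + natK n

  intK : ℤ → Carrier
  intK (+ n)      = natK n
  intK -[1+ n ]   = - natK (suc n)

  pow : Carrier → ℕ → Carrier
  pow x zero    = 1#
  pow x (suc n) = x * pow x n

  sumK : List Carrier → Carrier
  sumK = foldr _+_ 0#

  IsPermutationPolynomial : (Carrier → Carrier) → Set (c ⊔ ℓ)
  IsPermutationPolynomial f = Bijective _≈_ _≈_ f

-- coefficient (n-2i)/(n-i) * C(n-i,i) = C(n-i,i) - C(n-i-1,i-1), with C(m,-1) = 0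
dicksonCoeff : ℕ → ℕ → ℤ
dicksonCoeff n zero    = + ((n ∸ 0) C 0)
dicksonCoeff n (suc j) = + ((n ∸ suc j) C suc j) -ℤ + ((n ∸ suc j ∸ 1) C j)

reversedDickson3 : ∀ {q c ℓ} (K : FiniteField q c ℓ) → ℕ →
                   FiniteField.Carrier K → FiniteField.Carrier K → FiniteField.Carrier K
reversedDickson3 K n a x =
  sumK K (map (λ i → intK K (dicksonCoeff n i) * pow K (- x) i * pow K a (n ∸ 2 *ℕ i))
              (upTo (suc (n / 2))))
  where open FiniteField K

module Submission where

-- Put D = 1 - 4x and work in the ring R[√D].  The second-kind sums
-- E_n = Σ_i C(n-i, i)·(-x)^i satisfy E_{n+2} = E_{n+1} - x·E_n, and so, up to
-- powers of 2, do the √D-parts b_n of (1 + √D)^n: 2·b_{n+1} = 2^{n+1}·E_n.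
-- Moreover F_n = E_n + x·E_{n-2}.  In characteristic p the Frobenius map gives
-- (1 + √D)^{p^k} = 1 + D^m·√D with m = (p^k - 1)/2, hence F_{p^k}(1, x) = (1 - 4x)^m.
-- As x ↦ 1 - 4x is a bijection, F_{p^k}(1, ·) permutes K iff w ↦ w^m does, and
-- that holds iff gcd(m, q - 1) = 1: Fermat plus Bézout give an inverse power,
-- while a common divisor g ≥ 2 would make z ↦ z^g injective, against a root count.

open import Defs
open import Algebra.Bundles using (CommutativeRing; CommutativeMonoid)
open import Data.Nat using (ℕ)
open import Data.Fin using (Fin)
open import Function.Bundles using (Inverse)
open import Relation.Binary.Bundles using (Setoid)
open import Relation.Binary.PropositionalEquality using (_≡_)
import Relation.Binary.PropositionalEquality as ≡

module Arithmetic where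
  open import Data.Nat
  open import Data.Nat.Properties
  open import Data.Nat.Divisibility using (_∣_; ∣⇒≤; m∣m*n)
  open import Data.Nat.DivMod using (m≡m%n+[m/n]*n; %-distribˡ-*; m*n/n≡m; m/n*n≡m; /-monoˡ-≤; m/n≤m; m/n≡1+[m∸n]/n)
  open import Data.Nat.GCD using (gcd; gcd-GCD; module Bézout)
  open import Data.Nat.Primality using (Prime; euclidsLemma; prime⇒nonZero; prime⇒nonTrivial)
  open import Data.Nat.Combinatorics using (_C_; nCk≡n!/k![n-k]!; k![n∸k]!∣n!; k>n⇒nCk≡0; nCk+nC[k+1]≡[n+1]C[k+1])
  open import Data.Nat.Tactic.RingSolver using (solve-∀)
  open import Data.Empty using (⊥-elim)
  open import Data.Product using (Σ; _,_)
  open import Data.Sum using (inj₁; inj₂)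
  open import Relation.Binary.PropositionalEquality
  open import Relation.Nullary using (¬_; yes; no)

  prime∤! : ∀ {p} → Prime p → ∀ m → m < p → ¬ (p ∣ m !)
  prime∤! {p} pp zero m<p p∣1 = <⇒≱ (nonTrivial⇒n>1 p {{prime⇒nonTrivial pp}}) (∣⇒≤ p∣1)
  prime∤! pp (suc m) m<p p∣m! with euclidsLemma (suc m) (m !) pp p∣m!
  ... | inj₁ p∣m+1 = <⇒≱ m<p (∣⇒≤ p∣m+1)
  ... | inj₂ p∣m!′ = prime∤! pp m (<-trans (n<1+n m) m<p) p∣m!′

  n∣n! : ∀ n → .{{NonZero n}} → n ∣ n !
  n∣n! (suc n) = m∣m*n (n !)

  -- The inner binomial coefficients of a prime are divisible by it:
  -- p divides p! = (p C k) · k! · (p-k)! but neither k! nor (p-k)!.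
  prime∣binomial : ∀ {p k} → Prime p → 0 < k → k < p → p ∣ p C k
  prime∣binomial {p} {k} pp 0<k k<p
    with euclidsLemma (p C k) ((k !) * ((p ∸ k) !)) pp p∣product
    where
    instance _ = k !* (p ∸ k) !≢0
    p∣product : p ∣ (p C k) * ((k !) * ((p ∸ k) !))
    p∣product = subst (p ∣_)
      (sym (trans (cong (_* ((k !) * ((p ∸ k) !))) (nCk≡n!/k![n-k]! (<⇒≤ k<p)))
                  (m/n*n≡m (k![n∸k]!∣n! (<⇒≤ k<p)))))
      (n∣n! p {{prime⇒nonZero pp}})
  ... | inj₁ p∣C = p∣C
  ... | inj₂ p∣k![p-k]! with euclidsLemma (k !) ((p ∸ k) !) pp p∣k![p-k]!
  ...   | inj₁ p∣k!   = ⊥-elim (prime∤! pp k k<p p∣k!)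
  ...   | inj₂ p∣p-k! = ⊥-elim (prime∤! pp (p ∸ k) (∸-monoʳ-< 0<k (<⇒≤ k<p)) p∣p-k!)

  m*2≡m+m : ∀ m → m * 2 ≡ m + m
  m*2≡m+m = solve-∀

  odd-^ : ∀ n k → n % 2 ≡ 1 → (n ^ k) % 2 ≡ 1
  odd-^ n zero    n-odd = refl
  odd-^ n (suc k) n-odd = trans (%-distribˡ-* n (n ^ k) 2)
                                (cong₂ (λ a b → (a * b) % 2) n-odd (odd-^ n k n-odd))

  odd-split : ∀ n → n % 2 ≡ 1 → n ≡ suc ((n ∸ 1) / 2 + (n ∸ 1) / 2)
  odd-split n n-odd = trans n≡2h+1 (cong (λ h → suc (h + h)) (sym half≡))
    where
    n≡2h+1 : n ≡ suc (n / 2 + n / 2)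
    n≡2h+1 = trans (m≡m%n+[m/n]*n n 2) (cong₂ _+_ n-odd (m*2≡m+m (n / 2)))
    half≡ : (n ∸ 1) / 2 ≡ n / 2
    half≡ = trans (cong (λ m → (m ∸ 1) / 2) (trans (m≡m%n+[m/n]*n n 2) (cong (_+ n / 2 * 2) n-odd)))
                  (m*n/n≡m (n / 2) 2)

  odd-prime≥3 : ∀ {p} → Prime p → p % 2 ≡ 1 → 3 ≤ p
  odd-prime≥3 {suc (suc (suc _))} _ _ = s≤s (s≤s (s≤s z≤n))
  odd-prime≥3 {2}                 _ ()
  odd-prime≥3 {1}                 pp _ = ⊥-elim (<-irrefl refl (nonTrivial⇒n>1 1 {{prime⇒nonTrivial pp}}))
  odd-prime≥3 {0}                 pp _ = ⊥-elim (<⇒≱ (nonTrivial⇒n>1 0 {{prime⇒nonTrivial pp}}) z≤n)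

  2≤odd-prime^e∸1 : ∀ {p} e → Prime p → p % 2 ≡ 1 → 1 ≤ e → 2 ≤ p ^ e ∸ 1
  2≤odd-prime^e∸1 {p} (suc e) pp p-odd _ = ∸-monoˡ-≤ 1 (begin
    3          ≤⟨ odd-prime≥3 pp p-odd ⟩
    p          ≡⟨ sym (*-identityʳ p) ⟩
    p * 1      ≤⟨ *-monoʳ-≤ p (m^n>0 p {{>-nonZero (<-trans (s≤s z≤n) (odd-prime≥3 pp p-odd))}} e) ⟩
    p * p ^ e  ∎)
    where open ≤-Reasoning

  -- The library identity may come with the
  -- wrong sign (1 + x·m = y·n); multiplying it by n - 1 fixes the sign.
  bezout-inverse : ∀ m n → gcd m n ≡ 1 → 2 ≤ n → Σ ℕ λ a → Σ ℕ λ t → a * m ≡ suc (t * n)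
  bezout-inverse m n gcd≡1 2≤n
    with subst (λ d → Bézout.Identity d m n) gcd≡1 (Bézout.identity (gcd-GCD m n))
  ... | Bézout.+- x y eq = x , y , sym eq
  ... | Bézout.-+ x y eq = flip-sign y n 2≤n eq
    where
    scale : ∀ x m r → x * suc r * m + suc r ≡ suc r * (1 + x * m)
    scale = solve-∀
    expand : ∀ y r → suc r * (suc y * (2 + r)) ≡ suc ((y * suc r + r) * (2 + r)) + suc r
    expand = solve-∀
    flip-sign : ∀ y n → 2 ≤ n → 1 + x * m ≡ y * n → Σ ℕ λ a → Σ ℕ λ t → a * m ≡ suc (t * n)
    flip-sign _        (suc zero)    (s≤s ()) _
    flip-sign zero     (suc (suc r)) _ ()
    flip-sign (suc y′) (suc (suc r)) _ eq′ = x * suc r , y′ * suc r + r ,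
      +-cancelʳ-≡ (suc r) _ _ (trans (scale x m r) (trans (cong (suc r *_) eq′) (expand y′ r)))

  -- Exponent bookkeeping for the power map z ↦ z^g when q = 1 + H·g:
  -- g·(H + 1) = (g - 1) + q.
  exponent-shift : ∀ g′ H → suc g′ * suc H ≡ g′ + suc (H * suc g′)
  exponent-shift = solve-∀

  1+H*g≰1+H : ∀ H g → 1 ≤ H → 2 ≤ g → ¬ (suc (H * g) ≤ suc H)
  1+H*g≰1+H (suc h) g _ 2≤g (s≤s H*g≤H) = <⇒≱ (m<m*n (suc h) g 2≤g) H*g≤H

  -- Pascal's rule for the coefficients B(n, i) = C(n - i, i) of the Dickson
  -- sums, in the form B(n + 2, i + 1) = B(n + 1, i + 1) + B(n, i).
  pascal-shifted : ∀ n i → (suc n ∸ i) C suc i ≡ (n ∸ i) C suc i + (n ∸ i) C i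
  pascal-shifted n i with i ≤? n
  ... | yes i≤n = begin
    (suc n ∸ i) C suc i                ≡⟨ cong (_C suc i) (+-∸-assoc 1 i≤n) ⟩
    suc (n ∸ i) C suc i                ≡⟨ nCk+nC[k+1]≡[n+1]C[k+1] (n ∸ i) i ⟨
    (n ∸ i) C i + (n ∸ i) C suc i      ≡⟨ +-comm ((n ∸ i) C i) _ ⟩
    (n ∸ i) C suc i + (n ∸ i) C i      ∎
    where open ≡-Reasoning
  ... | no i≰n = beyond (≰⇒> i≰n)
    where
    beyond : n < i → (suc n ∸ i) C suc i ≡ (n ∸ i) C suc i + (n ∸ i) C i
    beyond n<i rewrite m≤n⇒m∸n≡0 n<i | m≤n⇒m∸n≡0 (<⇒≤ n<i) = empty i (≤-trans (s≤s z≤n) n<i)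
      where
      empty : ∀ i → 0 < i → 0 C suc i ≡ 0 C suc i + 0 C i
      empty (suc _) _ = refl

  -- B(n, i) = 0 once i exceeds n/2, since then n - i < i.
  binomial-vanishes : ∀ n i → suc (n / 2) ≤ i → (n ∸ i) C i ≡ 0
  binomial-vanishes n i@(suc _) n/2<i = k>n⇒nCk≡0 (m<n+o⇒m∸n<o n i n<i+i)
    where
    n<i+i : n < i + i
    n<i+i = subst (n <_) (m*2≡m+m i)
      (≰⇒> (λ i*2≤n → <⇒≱ n/2<i (subst (_≤ n / 2) (m*n/n≡m i 2) (/-monoˡ-≤ 2 i*2≤n))))

  ∸-suc-∸-1 : ∀ n j → n ∸ suc j ∸ 1 ≡ n ∸ 2 ∸ j
  ∸-suc-∸-1 n j = trans (∸-+-assoc n (suc j) 1) (trans (cong (n ∸_) (+-comm (suc j) 1)) (sym (∸-+-assoc n 2 j)))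

  [2+k]/2 : ∀ k → (2 + k) / 2 ≡ suc (k / 2)
  [2+k]/2 k = m/n≡1+[m∸n]/n {2 + k} {2} (s≤s (s≤s z≤n))

  half-range : ∀ n → suc (n / 2) ≤ suc n
  half-range n = s≤s (m/n≤m n 2)

-- The ring solver for an arbitrary commutative ring R, with integer
-- coefficients interpreted through the canonical map ℤ → R.  Integer
-- constants (2, 4, -1, ...) then normalise by evaluation.
module IntegerCoefficientSolver {c ℓ} (R : CommutativeRing c ℓ) where
  open import Algebra.Bundles using (RawRing)
  open import Algebra.Solver.Ring.AlmostCommutativeRing using (fromCommutativeRing; _-Raw-AlmostCommutative⟶_)
  open import Data.Nat as ℕ using (zero; suc)
  import Data.Nat.Properties as ℕ
  open import Data.Integer as ℤ using (ℤ; +_; -[1+_]; _⊖_)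
  import Data.Integer.Properties as ℤ
  open import Data.Sign as Sign using (Sign)
  open import Data.Maybe using (Maybe; just; nothing)
  open import Relation.Nullary using (yes; no)
  open CommutativeRing R
  open import Algebra.Properties.Semiring.Mult semiring using (_×_; ×-homo-+; ×1-homo-*)
  open import Algebra.Properties.Ring ring using (-‿distribˡ-*; -‿distribʳ-*; -0#≈0#; -‿involutive; -‿+-comm)
  open import Relation.Binary.Reasoning.Setoid setoid

  natR : ℕ → Carrier
  natR n = n × 1#

  intR : ℤ → Carrier
  intR (+ n)    = natR n
  intR -[1+ n ] = - natR (suc n)

  private
    cancel-1 : ∀ a b → (1# + a) + - (1# + b) ≈ a + - b
    cancel-1 a b = begin
      (1# + a) + - (1# + b)    ≈⟨ +-congˡ (-‿+-comm 1# b) ⟨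
      (1# + a) + (- 1# + - b)  ≈⟨ +-assoc 1# a _ ⟩
      1# + (a + (- 1# + - b))  ≈⟨ +-congˡ (trans (sym (+-assoc a _ _)) (trans (+-congʳ (+-comm a _)) (+-assoc _ a _))) ⟩
      1# + (- 1# + (a + - b))  ≈⟨ +-assoc 1# _ _ ⟨
      (1# + - 1#) + (a + - b)  ≈⟨ +-congʳ (-‿inverseʳ 1#) ⟩
      0# + (a + - b)           ≈⟨ +-identityˡ _ ⟩
      a + - b                  ∎

    intR-⊖ : ∀ m n → intR (m ⊖ n) ≈ natR m + - natR n
    intR-⊖ zero    zero    = sym (trans (+-congˡ -0#≈0#) (+-identityʳ _))
    intR-⊖ zero    (suc n) = sym (+-identityˡ _)
    intR-⊖ (suc m) zero    = sym (trans (+-congˡ -0#≈0#) (+-identityʳ _))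
    intR-⊖ (suc m) (suc n) = begin
      intR (suc m ⊖ suc n)              ≡⟨ ≡.cong intR (ℤ.[1+m]⊖[1+n]≡m⊖n m n) ⟩
      intR (m ⊖ n)                      ≈⟨ intR-⊖ m n ⟩
      natR m + - natR n                 ≈⟨ cancel-1 _ _ ⟨
      natR (suc m) + - natR (suc n)     ∎

  intR-+ : ∀ i j → intR (i ℤ.+ j) ≈ intR i + intR j
  intR-+ (+ m)    (+ n)    = ×-homo-+ 1# m n
  intR-+ (+ m)    -[1+ n ] = intR-⊖ m (suc n)
  intR-+ -[1+ m ] (+ n)    = trans (intR-⊖ n (suc m)) (+-comm _ _)
  intR-+ -[1+ m ] -[1+ n ] = begin
    - natR (suc (suc (m ℕ.+ n)))      ≡⟨ ≡.cong (λ k → - natR k) (≡.sym (ℕ.+-suc (suc m) n)) ⟩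
    - natR (suc m ℕ.+ suc n)          ≈⟨ -‿cong (×-homo-+ 1# (suc m) (suc n)) ⟩
    - (natR (suc m) + natR (suc n))   ≈⟨ -‿+-comm _ _ ⟨
    - natR (suc m) + - natR (suc n)   ∎

  intR-neg : ∀ i → intR (ℤ.- i) ≈ - intR i
  intR-neg (+ zero)  = sym -0#≈0#
  intR-neg (+ suc n) = refl
  intR-neg -[1+ n ]  = sym (-‿involutive _)

  private
    signed : Sign → Carrier → Carrier
    signed Sign.+ x = x
    signed Sign.- x = - x

    signed-cong : ∀ s {x y} → x ≈ y → signed s x ≈ signed s y
    signed-cong Sign.+ e = e
    signed-cong Sign.- e = -‿cong e

    intR-◃ : ∀ s k → intR (s ℤ.◃ k) ≈ signed s (natR k)
    intR-◃ Sign.+ zero    = refl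
    intR-◃ Sign.- zero    = sym -0#≈0#
    intR-◃ Sign.+ (suc k) = refl
    intR-◃ Sign.- (suc k) = refl

    intR-signed : ∀ i → intR i ≈ signed (ℤ.sign i) (natR ℤ.∣ i ∣)
    intR-signed (+ n)    = refl
    intR-signed -[1+ n ] = refl

    signed-* : ∀ s t x y → signed (s Sign.* t) (x * y) ≈ signed s x * signed t y
    signed-* Sign.+ Sign.+ x y = refl
    signed-* Sign.+ Sign.- x y = -‿distribʳ-* x y
    signed-* Sign.- Sign.+ x y = -‿distribˡ-* x y
    signed-* Sign.- Sign.- x y = begin
      x * y          ≈⟨ -‿involutive _ ⟨
      - - (x * y)    ≈⟨ -‿cong (-‿distribʳ-* x y) ⟩
      - (x * - y)    ≈⟨ -‿distribˡ-* x (- y) ⟩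
      - x * - y      ∎

  intR-* : ∀ i j → intR (i ℤ.* j) ≈ intR i * intR j
  intR-* i j = begin
    intR (i ℤ.* j)                                        ≈⟨ intR-◃ (s Sign.* t) (ℤ.∣ i ∣ ℕ.* ℤ.∣ j ∣) ⟩
    signed (s Sign.* t) (natR (ℤ.∣ i ∣ ℕ.* ℤ.∣ j ∣))      ≈⟨ signed-cong (s Sign.* t) (×1-homo-* ℤ.∣ i ∣ ℤ.∣ j ∣) ⟩
    signed (s Sign.* t) (natR ℤ.∣ i ∣ * natR ℤ.∣ j ∣)     ≈⟨ signed-* s t _ _ ⟩
    signed s (natR ℤ.∣ i ∣) * signed t (natR ℤ.∣ j ∣)     ≈⟨ *-cong (intR-signed i) (intR-signed j) ⟨
    intR i * intR j                                       ∎
    where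
    s t : Sign
    s = ℤ.sign i
    t = ℤ.sign j

  private
    ℤ-rawRing : RawRing _ _
    ℤ-rawRing = record { Carrier = ℤ ; _≈_ = _≡_ ; _+_ = ℤ._+_ ; _*_ = ℤ._*_ ; -_ = ℤ.-_ ; 0# = + 0 ; 1# = + 1 }

    intR-homomorphism : ℤ-rawRing -Raw-AlmostCommutative⟶ fromCommutativeRing R
    intR-homomorphism = record
      { ⟦_⟧ = intR ; +-homo = intR-+ ; *-homo = intR-* ; -‿homo = intR-neg
      ; 0-homo = refl ; 1-homo = +-identityʳ 1# }

    intR-equal? : ∀ i j → Maybe (intR i ≈ intR j)
    intR-equal? i j with i ℤ.≟ j
    ... | yes ≡.refl = just refl
    ... | no _       = nothing

  open import Algebra.Solver.Ring ℤ-rawRing (fromCommutativeRing R) intR-homomorphism intR-equal? public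

module Frobenius {c ℓ} (R : CommutativeRing c ℓ) where
  open import Data.Nat as ℕ using (zero; suc; _<_; s≤s; z≤n)
  import Data.Nat.Properties as ℕ
  open import Data.Nat.Divisibility using (_∣_; divides)
  open import Data.Nat.Primality using (Prime)
  open import Data.Nat.Combinatorics using (nCn≡1)
  open import Data.Fin using (zero; suc; toℕ; fromℕ; inject₁)
  import Data.Fin.Properties as Fin
  open import Data.Vec.Functional using (init; last; tail)
  open Arithmetic using (prime∣binomial)
  open CommutativeRing R hiding (zero)
  open import Algebra.Properties.Semiring.Exp semiring using (_^_; ^-congˡ; ^-assocʳ)
  open import Algebra.Properties.Semiring.Mult semiring using (_×_; ×-assocˡ; ×-congʳ; ×-assoc-*)
  open import Algebra.Properties.Semiring.Binomial semiring using (binomialTerm)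
  import Algebra.Properties.CommutativeSemiring.Binomial commutativeSemiring as Binomial
  open import Algebra.Properties.Semiring.Sum semiring using (sum; sum-init-last; sum-cong-≋; sum-replicate-zero)
  open import Relation.Binary.Reasoning.Setoid setoid

  1#^ : ∀ n → 1# ^ n ≈ 1#
  1#^ zero    = refl
  1#^ (suc n) = trans (*-identityˡ _) (1#^ n)

  multiple-of-char : ∀ {p} → p × 1# ≈ 0# → ∀ {m} z → p ∣ m → m × z ≈ 0#
  multiple-of-char {p} char z (divides r ≡.refl) = begin
    (r ℕ.* p) × z    ≈⟨ ×-assocˡ z r p ⟨
    r × (p × z)      ≈⟨ ×-congʳ r p×z≈0 ⟩
    r × 0#           ≈⟨ r×0≈0 r ⟩
    0#               ∎
    where
    p×z≈0 : p × z ≈ 0#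
    p×z≈0 = begin
      p × z            ≈⟨ ×-congʳ p (*-identityˡ z) ⟨
      p × (1# * z)     ≈⟨ ×-assoc-* p 1# z ⟨
      (p × 1#) * z     ≈⟨ *-congʳ char ⟩
      0# * z           ≈⟨ zeroˡ z ⟩
      0#               ∎
    r×0≈0 : ∀ n → n × 0# ≈ 0#
    r×0≈0 zero    = refl
    r×0≈0 (suc n) = trans (+-identityˡ _) (r×0≈0 n)

  -- (a + b)^p = a^p + b^p: all inner binomial terms vanish.
  frobenius-additive : ∀ {p} → Prime p → p × 1# ≈ 0# → ∀ a b → (a + b) ^ p ≈ a ^ p + b ^ p
  frobenius-additive {zero} () _
  frobenius-additive {suc p′} pp char a b = begin
    (a + b) ^ p                                         ≈⟨ Binomial.theorem p a b ⟩
    sum t                                               ≈⟨ +-congˡ (sum-init-last (tail t)) ⟩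
    t zero + (sum (init (tail t)) + last (tail t))      ≈⟨ +-cong bottom (+-cong inner top) ⟩
    b ^ p + (0# + a ^ p)                                ≈⟨ trans (+-congˡ (+-identityˡ _)) (+-comm _ _) ⟩
    a ^ p + b ^ p                                       ∎
    where
    p : ℕ
    p = suc p′
    t : Fin (suc p) → Carrier
    t = binomialTerm a b p
    bottom : t zero ≈ b ^ p
    bottom = trans (+-identityʳ _) (*-identityˡ _)
    top-at : ∀ k → toℕ k ≡ p → t k ≈ a ^ p
    top-at k k≡p rewrite k≡p | nCn≡1 p | ℕ.n∸n≡0 p = trans (+-identityʳ _) (*-identityʳ _)
    top : t (fromℕ p) ≈ a ^ p
    top = top-at (fromℕ p) (Fin.toℕ-fromℕ p)
    inner : sum (init (tail t)) ≈ 0#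
    inner = trans (sum-cong-≋ (λ i → middle (suc (inject₁ i)) (s≤s z≤n)
                    (s≤s (≡.subst (ℕ._< p′) (≡.sym (Fin.toℕ-inject₁ i)) (Fin.toℕ<n i)))))
                  (sum-replicate-zero p′)
      where
      middle : ∀ k → 0 < toℕ k → toℕ k < p → t k ≈ 0#
      middle k 0<k k<p = multiple-of-char char _ (prime∣binomial pp 0<k k<p)

  frobenius-iterate-additive : ∀ {p} → Prime p → p × 1# ≈ 0# →
                               ∀ k a b → (a + b) ^ (p ℕ.^ k) ≈ a ^ (p ℕ.^ k) + b ^ (p ℕ.^ k)
  frobenius-iterate-additive pp char zero a b = trans (*-identityʳ _) (sym (+-cong (*-identityʳ a) (*-identityʳ b)))
  frobenius-iterate-additive {p} pp char (suc k) a b = begin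
    (a + b) ^ (p ℕ.* p ℕ.^ k)                   ≈⟨ ^-assocʳ (a + b) p (p ℕ.^ k) ⟨
    ((a + b) ^ p) ^ (p ℕ.^ k)                   ≈⟨ ^-congˡ (p ℕ.^ k) (frobenius-additive pp char a b) ⟩
    (a ^ p + b ^ p) ^ (p ℕ.^ k)                 ≈⟨ frobenius-iterate-additive pp char k (a ^ p) (b ^ p) ⟩
    (a ^ p) ^ (p ℕ.^ k) + (b ^ p) ^ (p ℕ.^ k)   ≈⟨ +-cong (^-assocʳ a p (p ℕ.^ k)) (^-assocʳ b p (p ℕ.^ k)) ⟩
    a ^ (p ℕ.* p ℕ.^ k) + b ^ (p ℕ.* p ℕ.^ k)   ∎

-- The ring R[√D] = R[t]/(t² - D), represented by pairs (a , b) = a + b√D.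
-- No assumption on D is needed: the ring laws are polynomial identities.
module QuadraticExtension {c ℓ} (R : CommutativeRing c ℓ) (D : CommutativeRing.Carrier R) where
  open import Algebra.Structures using (IsCommutativeRing)
  open import Data.Product using (_×_; _,_)
  open CommutativeRing R
  open IntegerCoefficientSolver R using (solve; _:+_; _:*_; _:=_)

  Pair : Set c
  Pair = Carrier × Carrier

  _≈ₚ_ : Pair → Pair → Set ℓ
  (a , b) ≈ₚ (c , d) = (a ≈ c) × (b ≈ d)

  _+ₚ_ _*ₚ_ : Pair → Pair → Pair
  (a , b) +ₚ (c , d) = (a + c , b + d)
  (a , b) *ₚ (c , d) = (a * c + D * (b * d) , a * d + b * c)

  -ₚ_ : Pair → Pair
  -ₚ (a , b) = (- a , - b)

  0ₚ 1ₚ : Pair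
  0ₚ = (0# , 0#)
  1ₚ = (1# , 0#)

  private
    assoc₁ : ∀ D a b c d e f → (a * c + D * (b * d)) * e + D * ((a * d + b * c) * f) ≈
                               a * (c * e + D * (d * f)) + D * (b * (c * f + d * e))
    assoc₁ = solve 7 (λ D a b c d e f → (a :* c :+ D :* (b :* d)) :* e :+ D :* ((a :* d :+ b :* c) :* f) :=
                                        a :* (c :* e :+ D :* (d :* f)) :+ D :* (b :* (c :* f :+ d :* e))) refl
    assoc₂ : ∀ D a b c d e f → (a * c + D * (b * d)) * f + (a * d + b * c) * e ≈
                               a * (c * f + d * e) + b * (c * e + D * (d * f))
    assoc₂ = solve 7 (λ D a b c d e f → (a :* c :+ D :* (b :* d)) :* f :+ (a :* d :+ b :* c) :* e :=
                                        a :* (c :* f :+ d :* e) :+ b :* (c :* e :+ D :* (d :* f))) refl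
    distribˡ₁ : ∀ D a b c d e f → a * (c + e) + D * (b * (d + f)) ≈ (a * c + D * (b * d)) + (a * e + D * (b * f))
    distribˡ₁ = solve 7 (λ D a b c d e f → a :* (c :+ e) :+ D :* (b :* (d :+ f)) :=
                                           (a :* c :+ D :* (b :* d)) :+ (a :* e :+ D :* (b :* f))) refl
    distribˡ₂ : ∀ a b c d e f → a * (d + f) + b * (c + e) ≈ (a * d + b * c) + (a * f + b * e)
    distribˡ₂ = solve 6 (λ a b c d e f → a :* (d :+ f) :+ b :* (c :+ e) := (a :* d :+ b :* c) :+ (a :* f :+ b :* e)) refl
    distribʳ₁ : ∀ D a b c d e f → (c + e) * a + D * ((d + f) * b) ≈ (c * a + D * (d * b)) + (e * a + D * (f * b))
    distribʳ₁ = solve 7 (λ D a b c d e f → (c :+ e) :* a :+ D :* ((d :+ f) :* b) :=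
                                           (c :* a :+ D :* (d :* b)) :+ (e :* a :+ D :* (f :* b))) refl
    distribʳ₂ : ∀ a b c d e f → (c + e) * b + (d + f) * a ≈ (c * b + d * a) + (e * b + f * a)
    distribʳ₂ = solve 6 (λ a b c d e f → (c :+ e) :* b :+ (d :+ f) :* a := (c :* b :+ d :* a) :+ (e :* b :+ f :* a)) refl
    comm₁ : ∀ D a b c d → a * c + D * (b * d) ≈ c * a + D * (d * b)
    comm₁ = solve 5 (λ D a b c d → a :* c :+ D :* (b :* d) := c :* a :+ D :* (d :* b)) refl
    comm₂ : ∀ a b c d → a * d + b * c ≈ c * b + d * a
    comm₂ = solve 4 (λ a b c d → a :* d :+ b :* c := c :* b :+ d :* a) refl
    identityˡ₁ : ∀ c d → 1# * c + D * (0# * d) ≈ c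
    identityˡ₁ c d = trans (+-cong (*-identityˡ c) (trans (*-congˡ (zeroˡ d)) (zeroʳ D))) (+-identityʳ c)
    identityˡ₂ : ∀ c d → 1# * d + 0# * c ≈ d
    identityˡ₂ c d = trans (+-cong (*-identityˡ d) (zeroˡ c)) (+-identityʳ d)
    identityʳ₁ : ∀ c d → c * 1# + D * (d * 0#) ≈ c
    identityʳ₁ c d = trans (+-cong (*-identityʳ c) (trans (*-congˡ (zeroʳ d)) (zeroʳ D))) (+-identityʳ c)
    identityʳ₂ : ∀ c d → c * 0# + d * 1# ≈ d
    identityʳ₂ c d = trans (+-cong (zeroʳ c) (*-identityʳ d)) (+-identityˡ d)

  isCommutativeRingₚ : IsCommutativeRing _≈ₚ_ _+ₚ_ _*ₚ_ -ₚ_ 0ₚ 1ₚ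
  isCommutativeRingₚ = record
    { isRing = record
      { +-isAbelianGroup = record
        { isGroup = record
          { isMonoid = record
            { isSemigroup = record
              { isMagma = record
                { isEquivalence = record
                  { refl  = refl , refl
                  ; sym   = λ { (x , y) → sym x , sym y }
                  ; trans = λ { (x , y) (u , v) → trans x u , trans y v } }
                ; ∙-cong = λ { (x , y) (u , v) → +-cong x u , +-cong y v } }
              ; assoc = λ { (a , b) (c , d) (e , f) → +-assoc a c e , +-assoc b d f } }
            ; identity = (λ { (a , b) → +-identityˡ a , +-identityˡ b })
                       , (λ { (a , b) → +-identityʳ a , +-identityʳ b }) }
          ; inverse = (λ { (a , b) → -‿inverseˡ a , -‿inverseˡ b })
                    , (λ { (a , b) → -‿inverseʳ a , -‿inverseʳ b })
          ; ⁻¹-cong = λ { (x , y) → -‿cong x , -‿cong y } }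
        ; comm = λ { (a , b) (c , d) → +-comm a c , +-comm b d } }
      ; *-cong = λ { (x , y) (u , v) → +-cong (*-cong x u) (*-congˡ (*-cong y v)) , +-cong (*-cong x v) (*-cong y u) }
      ; *-assoc = λ { (a , b) (c , d) (e , f) → assoc₁ D a b c d e f , assoc₂ D a b c d e f }
      ; *-identity = (λ { (c , d) → identityˡ₁ c d , identityˡ₂ c d })
                   , (λ { (c , d) → identityʳ₁ c d , identityʳ₂ c d })
      ; distrib = (λ { (a , b) (c , d) (e , f) → distribˡ₁ D a b c d e f , distribˡ₂ a b c d e f })
                , (λ { (a , b) (c , d) (e , f) → distribʳ₁ D a b c d e f , distribʳ₂ a b c d e f }) }
    ; *-comm = λ { (a , b) (c , d) → comm₁ D a b c d , comm₂ a b c d } }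

  R[√D] : CommutativeRing c ℓ
  R[√D] = record { isCommutativeRing = isCommutativeRingₚ }

module EnumeratedSum {a l} (M : CommutativeMonoid a l) {n : ℕ}
                     (enum : Inverse (≡.setoid (Fin n)) (CommutativeMonoid.setoid M)) where
  open import Data.Fin.Permutation using (Permutation; permutation)
  open CommutativeMonoid M
  open Inverse enum using (to; from; from-cong; strictlyInverseˡ; strictlyInverseʳ)
  open import Algebra.Properties.CommutativeMonoid.Sum M using (sum; sum-permute; sum-cong-≋)

  Σ-all : (Carrier → Carrier) → Carrier
  Σ-all g = sum (λ i → g (to i))

  Σ-all-reindex : ∀ (g σ σ⁻¹ : Carrier → Carrier) →
                  (∀ {x y} → x ≈ y → g x ≈ g y) →
                  (∀ {x y} → x ≈ y → σ x ≈ σ y) → (∀ {x y} → x ≈ y → σ⁻¹ x ≈ σ⁻¹ y) →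
                  (∀ y → σ (σ⁻¹ y) ≈ y) → (∀ y → σ⁻¹ (σ y) ≈ y) →
                  Σ-all g ≈ Σ-all (λ x → g (σ x))
  Σ-all-reindex g σ σ⁻¹ g-cong σ-cong σ⁻¹-cong σσ⁻¹ σ⁻¹σ =
    trans (sum-permute (λ i → g (to i)) π) (sum-cong-≋ (λ i → g-cong (strictlyInverseˡ (σ (to i)))))
    where
    π : Permutation n n
    π = permutation (λ i → from (σ (to i))) (λ j → from (σ⁻¹ (to j)))
      (λ j → ≡.trans (from-cong (trans (σ-cong (strictlyInverseˡ (σ⁻¹ (to j)))) (σσ⁻¹ (to j)))) (strictlyInverseʳ j))
      (λ i → ≡.trans (from-cong (trans (σ⁻¹-cong (strictlyInverseˡ (σ (to i)))) (σ⁻¹σ (to i)))) (strictlyInverseʳ i))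

module FiniteFieldFacts {q c ℓ} (K : FiniteField q c ℓ) where
  open import Data.Nat as ℕ using (zero; suc; _∸_; _≤_; s≤s; z≤n; NonZero)
  import Data.Nat.Properties as ℕ
  open import Data.Nat.Divisibility using (divides)
  open import Data.Nat.DivMod using (m≡m%n+[m/n]*n)
  open import Data.Nat.GCD using (gcd; gcd[m,n]∣m; gcd[m,n]∣n; gcd[m,n]≡0⇒n≡0)
  import Data.Fin as Fin
  import Data.Fin.Properties as Fin
  open import Data.List using (List; []; _∷_; length; tabulate)
  import Data.List.Properties as List
  open import Data.List.Relation.Unary.All as All using (All; []; _∷_)
  import Data.List.Relation.Unary.All.Properties as All
  open import Data.List.Relation.Unary.AllPairs using (AllPairs; []; _∷_)
  import Data.List.Relation.Unary.AllPairs.Properties as AllPairs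
  open import Data.Product using (_×_; _,_; proj₁; proj₂)
  open import Data.Sum using (_⊎_; inj₁; inj₂)
  open import Data.Empty using (⊥-elim)
  open import Relation.Nullary using (¬_; Dec; yes; no)
  open import Function.Bundles using (_⇔_; mk⇔)
  open import Function.Definitions using (Injective; Bijective)
  import Function.Consequences.Setoid as FunctionConsequences
  open Arithmetic using (bezout-inverse; exponent-shift; 1+H*g≰1+H)
  open FiniteField K hiding (zero)
  open Inverse enum using (to; from; from-cong; strictlyInverseˡ; strictlyInverseʳ)
  open import Algebra.Properties.Semiring.Exp semiring using (_^_; ^-congˡ; ^-homo-*; ^-assocʳ)
  open import Algebra.Properties.Semiring.Mult semiring using (×1-homo-*)
  open import Algebra.Properties.CommutativeMonoid.Sum +-commutativeMonoid using (sum; ∑-distrib-+; sum-replicate)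
  open import Algebra.Properties.CommutativeMonoid.Sum *-commutativeMonoid using ()
    renaming (sum to product; ∑-distrib-+ to ∏-distrib-*; sum-replicate to product-replicate; sum-cong-≋ to product-cong)
  open import Algebra.Properties.Group +-group using () renaming (∙-cancelʳ to +-cancelʳ)
  open IntegerCoefficientSolver commRing using (solve; _:+_; _:*_; :-_; _:=_; natR)
  open import Relation.Binary.Reasoning.Setoid setoid

  _≟_ : ∀ x y → Dec (x ≈ y)
  x ≟ y with from x Fin.≟ from y
  ... | yes i≡j = yes (trans (sym (strictlyInverseˡ x)) (trans (reflexive (≡.cong to i≡j)) (strictlyInverseˡ y)))
  ... | no  i≢j = no (λ x≈y → i≢j (from-cong x≈y))

  q≢0 : NonZero q
  q≢0 = nonZero (from 0#)
    where
    nonZero : ∀ {n} → Fin n → NonZero n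
    nonZero Fin.zero    = _
    nonZero (Fin.suc _) = _

  _⁻¹⟨_⟩ : ∀ x → x ≉ 0# → Carrier
  x ⁻¹⟨ x≉0 ⟩ = proj₁ (inverse x x≉0)

  *-inverseʳ : ∀ x (x≉0 : x ≉ 0#) → x * x ⁻¹⟨ x≉0 ⟩ ≈ 1#
  *-inverseʳ x x≉0 = proj₂ (inverse x x≉0)

  *-cancelˡ : ∀ x {y z} → x ≉ 0# → x * y ≈ x * z → y ≈ z
  *-cancelˡ x {y} {z} x≉0 xy≈xz = begin
    y                  ≈⟨ *-identityˡ y ⟨
    1# * y             ≈⟨ *-congʳ (trans (*-comm _ _) (*-inverseʳ x x≉0)) ⟨
    (x⁻¹ * x) * y      ≈⟨ *-assoc _ _ _ ⟩
    x⁻¹ * (x * y)      ≈⟨ *-congˡ xy≈xz ⟩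
    x⁻¹ * (x * z)      ≈⟨ *-assoc _ _ _ ⟨
    (x⁻¹ * x) * z      ≈⟨ *-congʳ (trans (*-comm _ _) (*-inverseʳ x x≉0)) ⟩
    1# * z             ≈⟨ *-identityˡ z ⟩
    z                  ∎
    where x⁻¹ = x ⁻¹⟨ x≉0 ⟩

  *-≉0 : ∀ {x y} → x ≉ 0# → y ≉ 0# → x * y ≉ 0#
  *-≉0 {x} x≉0 y≉0 xy≈0 = y≉0 (*-cancelˡ x x≉0 (trans xy≈0 (sym (zeroʳ x))))

  ^-≉0 : ∀ {x} n → x ≉ 0# → x ^ n ≉ 0#
  ^-≉0 zero    x≉0 = λ 1≈0 → 0≉1 (sym 1≈0)
  ^-≉0 (suc n) x≉0 = *-≉0 x≉0 (^-≉0 n x≉0)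

  zero-divisor : ∀ {x y} → x * y ≈ 0# → x ≈ 0# ⊎ y ≈ 0#
  zero-divisor {x} {y} xy≈0 with x ≟ 0# | y ≟ 0#
  ... | yes x≈0 | _       = inj₁ x≈0
  ... | no  _   | yes y≈0 = inj₂ y≈0
  ... | no  x≉0 | no  y≉0 = ⊥-elim (*-≉0 x≉0 y≉0 xy≈0)

  ^≈0⇒≈0 : ∀ {x} n → x ^ n ≈ 0# → x ≈ 0#
  ^≈0⇒≈0 {x} n x^n≈0 with x ≟ 0#
  ... | yes x≈0 = x≈0
  ... | no  x≉0 = ⊥-elim (^-≉0 n x≉0 x^n≈0)

  private
    module Additive       = EnumeratedSum +-commutativeMonoid enum
    module Multiplicative = EnumeratedSum *-commutativeMonoid enum

  -- q · 1 = 0: translating by 1 permutes K, so Σ x = Σ (x + 1) = Σ x + q · 1.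
  characteristic : natR q ≈ 0#
  characteristic = sym (+-cancelʳ Σx 0# (natR q) (begin
    0# + Σx                      ≈⟨ +-identityˡ Σx ⟩
    Σx                           ≈⟨ Additive.Σ-all-reindex (λ x → x) (_+ 1#) (_+ - 1#) (λ e → e) +-congʳ +-congʳ
                                      (λ y → solve 2 (λ y u → (y :+ :- u) :+ u := y) refl y 1#)
                                      (λ y → solve 2 (λ y u → (y :+ u) :+ :- u := y) refl y 1#) ⟩
    sum (λ i → to i + 1#)        ≈⟨ ∑-distrib-+ to (λ _ → 1#) ⟩
    Σx + sum {q} (λ _ → 1#)      ≈⟨ +-congˡ (sum-replicate q) ⟩
    Σx + natR q                  ≈⟨ +-comm _ _ ⟩
    natR q + Σx                  ∎))
    where
    Σx : Carrier
    Σx = Additive.Σ-all (λ x → x)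

  characteristic-of-prime-power : ∀ p e → q ≡ p ℕ.^ e → natR p ≈ 0#
  characteristic-of-prime-power p e q≡p^e =
    ^≈0⇒≈0 e (trans (sym (natR-^ e)) (≡.subst (λ n → natR n ≈ 0#) q≡p^e characteristic))
    where
    natR-^ : ∀ e → natR (p ℕ.^ e) ≈ natR p ^ e
    natR-^ zero    = +-identityʳ 1#
    natR-^ (suc e) = trans (×1-homo-* p (p ℕ.^ e)) (*-congˡ (natR-^ e))

  -- In odd characteristic 2 ≠ 0: otherwise 0 = p · 1 = 1 + (p/2)·2 = 1.
  two≉0 : ∀ p → natR p ≈ 0# → p ℕ.% 2 ≡ 1 → natR 2 ≉ 0#
  two≉0 p char p-odd 2≈0 = 0≉1 (sym (begin
    1#                        ≈⟨ +-identityʳ 1# ⟨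
    1# + 0#                   ≈⟨ +-congˡ (trans (×1-homo-* (p ℕ./ 2) 2) (trans (*-congˡ 2≈0) (zeroʳ _))) ⟨
    natR (1 ℕ.+ p ℕ./ 2 ℕ.* 2) ≡⟨ ≡.cong natR (≡.trans (≡.cong (ℕ._+ p ℕ./ 2 ℕ.* 2) (≡.sym p-odd)) (≡.sym (m≡m%n+[m/n]*n p 2))) ⟩
    natR p                    ≈⟨ char ⟩
    0#                        ∎))

  product-single : ∀ {n} (f : Fin n → Carrier) i₀ → (∀ i → ¬ (i ≡ i₀) → f i ≈ 1#) → product f ≈ f i₀
  product-single f Fin.zero     others = trans (*-congˡ (ones (λ i → others (Fin.suc i) (λ ())))) (*-identityʳ _)
    where
    ones : ∀ {n} {g : Fin n → Carrier} → (∀ i → g i ≈ 1#) → product g ≈ 1#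
    ones {zero}  g≈1 = refl
    ones {suc n} g≈1 = trans (*-cong (g≈1 Fin.zero) (ones (λ i → g≈1 (Fin.suc i)))) (*-identityˡ 1#)
  product-single f (Fin.suc i₀) others =
    trans (*-congʳ (others Fin.zero (λ ())))
          (trans (*-identityˡ _)
                 (product-single (λ i → f (Fin.suc i)) i₀ (λ i i≢i₀ → others (Fin.suc i) (λ eq → i≢i₀ (Fin.suc-injective eq)))))

  product-≉0 : ∀ {n} {f : Fin n → Carrier} → (∀ i → f i ≉ 0#) → product f ≉ 0#
  product-≉0 {zero}  _   = λ 1≈0 → 0≉1 (sym 1≈0)
  product-≉0 {suc n} f≉0 = *-≉0 (f≉0 Fin.zero) (product-≉0 (λ i → f≉0 (Fin.suc i)))

  nonzero-part : Carrier → Carrier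
  nonzero-part x with x ≟ 0#
  ... | yes _ = 1#
  ... | no  _ = x

  nonzero-part-cong : ∀ {x x′} → x ≈ x′ → nonzero-part x ≈ nonzero-part x′
  nonzero-part-cong {x} {x′} x≈x′ with x ≟ 0# | x′ ≟ 0#
  ... | yes _   | yes _    = refl
  ... | yes x≈0 | no  x′≉0 = ⊥-elim (x′≉0 (trans (sym x≈x′) x≈0))
  ... | no  x≉0 | yes x′≈0 = ⊥-elim (x≉0 (trans x≈x′ x′≈0))
  ... | no  _   | no  _    = x≈x′

  nonzero-part≉0 : ∀ x → nonzero-part x ≉ 0#
  nonzero-part≉0 x with x ≟ 0#
  ... | yes _   = λ 1≈0 → 0≉1 (sym 1≈0)
  ... | no  x≉0 = x≉0

  -- For y ≠ 0, scaling by y multiplies the nonzero part by y except at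
  -- x = 0; the correction factor (y at 0, 1 elsewhere) has product y.
  module Scaling (y : Carrier) (y≉0 : y ≉ 0#) where
    correction : Carrier → Carrier
    correction x with x ≟ 0#
    ... | yes _ = y
    ... | no  _ = 1#

    nonzero-part-scaling : ∀ x → nonzero-part (y * x) * correction x ≈ y * nonzero-part x
    nonzero-part-scaling x with x ≟ 0# | (y * x) ≟ 0#
    ... | yes _   | yes _     = trans (*-identityˡ y) (sym (*-identityʳ y))
    ... | yes x≈0 | no  yx≉0  = ⊥-elim (yx≉0 (trans (*-congˡ x≈0) (zeroʳ y)))
    ... | no  x≉0 | yes yx≈0  = ⊥-elim (*-≉0 y≉0 x≉0 yx≈0)
    ... | no  _   | no  _     = *-identityʳ _

    product-correction : product (λ i → correction (to i)) ≈ y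
    product-correction = trans (product-single (λ i → correction (to i)) (from 0#) elsewhere) at-zero
      where
      at-zero : correction (to (from 0#)) ≈ y
      at-zero with to (from 0#) ≟ 0#
      ... | yes _  = refl
      ... | no  ≉0 = ⊥-elim (≉0 (strictlyInverseˡ 0#))
      elsewhere : ∀ i → ¬ (i ≡ from 0#) → correction (to i) ≈ 1#
      elsewhere i i≢ with to i ≟ 0#
      ... | yes i≈0 = ⊥-elim (i≢ (≡.trans (≡.sym (strictlyInverseʳ i)) (from-cong i≈0)))
      ... | no  _   = refl

    -- multiplication by y permutes K
    product-scaled : product (λ i → nonzero-part (y * to i)) ≈ product (λ i → nonzero-part (to i))
    product-scaled = sym (Multiplicative.Σ-all-reindex nonzero-part (y *_) (y⁻¹ *_) nonzero-part-cong *-congˡ *-congˡ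
                            (cancel (*-inverseʳ y y≉0)) (cancel (trans (*-comm _ _) (*-inverseʳ y y≉0))))
      where
      y⁻¹ : Carrier
      y⁻¹ = y ⁻¹⟨ y≉0 ⟩
      cancel : ∀ {a b} → a * b ≈ 1# → ∀ z → a * (b * z) ≈ z
      cancel ab≈1 z = trans (sym (*-assoc _ _ _)) (trans (*-congʳ ab≈1) (*-identityˡ z))

  -- Fermat's little theorem y^q = y.  For y ≠ 0, with P = Π h(x) over all x
  -- and h the nonzero part: P·y = Π h(y·x) · Π e(x) = Π y·h(x) = y^q·P, and P ≠ 0.
  fermat : ∀ y → y ^ q ≈ y
  fermat y with y ≟ 0#
  ... | yes y≈0 = trans (^-congˡ q y≈0) (trans (0#^ q q≢0) (sym y≈0))
    where
    0#^ : ∀ n → NonZero n → 0# ^ n ≈ 0#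
    0#^ (suc n) _ = zeroˡ _
  ... | no  y≉0 = sym (*-cancelˡ P (product-≉0 (λ i → nonzero-part≉0 (to i))) (begin
    P * y                                        ≈⟨ *-cong (sym product-scaled) (sym product-correction) ⟩
    product (λ i → h (y * to i)) * product (λ i → correction (to i))
                                                 ≈⟨ ∏-distrib-* (λ i → h (y * to i)) (λ i → correction (to i)) ⟨
    product (λ i → h (y * to i) * correction (to i))
                                                 ≈⟨ product-cong (λ i → nonzero-part-scaling (to i)) ⟩
    product (λ i → y * h (to i))                 ≈⟨ ∏-distrib-* (λ _ → y) (λ i → h (to i)) ⟩
    product {q} (λ _ → y) * P                    ≈⟨ *-congʳ (product-replicate q) ⟩
    y ^ q * P                                    ≈⟨ *-comm _ _ ⟩
    P * y ^ q                                    ∎))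
    where
    open Scaling y y≉0
    h : Carrier → Carrier
    h = nonzero-part
    P : Carrier
    P = product (λ i → h (to i))

  fermat-iterate : ∀ t z → z ^ suc (t ℕ.* (q ∸ 1)) ≈ z
  fermat-iterate zero    z = trans (reflexive (≡.cong (λ n → z ^ suc n) (ℕ.*-zeroˡ (q ∸ 1)))) (*-identityʳ z)
  fermat-iterate (suc t) z = begin
    z ^ suc ((q ∸ 1) ℕ.+ t ℕ.* (q ∸ 1))   ≡⟨ ≡.cong (z ^_) (ℕ.+-suc (q ∸ 1) (t ℕ.* (q ∸ 1))) ⟨
    z ^ ((q ∸ 1) ℕ.+ suc (t ℕ.* (q ∸ 1))) ≈⟨ ^-homo-* z (q ∸ 1) _ ⟩
    z ^ (q ∸ 1) * z ^ suc (t ℕ.* (q ∸ 1)) ≈⟨ *-congˡ (fermat-iterate t z) ⟩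
    z ^ (q ∸ 1) * z                       ≈⟨ *-comm _ _ ⟩
    z ^ suc (q ∸ 1)                       ≡⟨ ≡.cong (z ^_) (ℕ.suc-pred q {{q≢0}}) ⟩
    z ^ q                                 ≈⟨ fermat z ⟩
    z                                     ∎

  -- Monic polynomials of degree d: a ∷ₘ M stands for a + X·M.
  data Monic : ℕ → Set c where
    1ₘ   : Monic 0
    _∷ₘ_ : ∀ {d} → Carrier → Monic d → Monic (suc d)

  eval : ∀ {d} → Monic d → Carrier → Carrier
  eval 1ₘ       z = 1#
  eval (a ∷ₘ M) z = z * eval M z + a

  divide : ∀ {d} → Monic (suc d) → Carrier → Monic d × Carrier
  divide (a₀ ∷ₘ 1ₘ)        a = 1ₘ , a + a₀
  divide (a₀ ∷ₘ (a₁ ∷ₘ M)) a with divide (a₁ ∷ₘ M) a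
  ... | Q , r = (r ∷ₘ Q) , a * r + a₀

  divide-correct : ∀ {d} (P : Monic (suc d)) a z →
                   eval P z ≈ (z + - a) * eval (proj₁ (divide P a)) z + proj₂ (divide P a)
  divide-correct (a₀ ∷ₘ 1ₘ) a z = trans (+-congʳ (*-identityʳ z))
    (trans (solve 3 (λ z a a₀ → z :+ a₀ := (z :+ :- a) :+ (a :+ a₀)) refl z a a₀) (+-congʳ (sym (*-identityʳ _))))
  divide-correct (a₀ ∷ₘ (a₁ ∷ₘ M)) a z with divide (a₁ ∷ₘ M) a | divide-correct (a₁ ∷ₘ M) a z
  ... | Q , r | Q-correct = trans (+-congʳ (*-congˡ Q-correct))
    (solve 5 (λ z a Q r a₀ → z :* ((z :+ :- a) :* Q :+ r) :+ a₀ := (z :+ :- a) :* (z :* Q :+ r) :+ (a :* r :+ a₀))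
           refl z a (eval Q z) r a₀)

  -- A monic polynomial of degree d has at most d distinct roots: dividing
  -- out one root a leaves a quotient vanishing at all the other roots.
  root-bound : ∀ {d} (P : Monic d) (xs : List Carrier) →
               AllPairs (λ a b → a ≉ b) xs → All (λ z → eval P z ≈ 0#) xs → length xs ≤ d
  root-bound P        []       _              _             = z≤n
  root-bound 1ₘ       (a ∷ xs) _              (1≈0 ∷ _)     = ⊥-elim (0≉1 (sym 1≈0))
  root-bound {suc d} (a₀ ∷ₘ M) (a ∷ xs) (a≉xs ∷ xs-distinct) (Pa≈0 ∷ Pxs≈0) =
    s≤s (root-bound Q xs xs-distinct (All.zipWith (λ (a≉z , Pz≈0) → Q-root a≉z Pz≈0) (a≉xs , Pxs≈0)))
    where
    P : Monic (suc d)
    P = a₀ ∷ₘ M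
    Q : Monic d
    Q = proj₁ (divide P a)
    r : Carrier
    r = proj₂ (divide P a)
    r≈0 : r ≈ 0#
    r≈0 = begin
      r                                     ≈⟨ trans (+-congʳ (zeroˡ _)) (+-identityˡ r) ⟨
      0# * eval Q a + r                     ≈⟨ +-congʳ (*-congʳ (-‿inverseʳ a)) ⟨
      (a + - a) * eval Q a + r              ≈⟨ divide-correct P a a ⟨
      eval P a                              ≈⟨ Pa≈0 ⟩
      0#                                    ∎
    Q-root : ∀ {z} → a ≉ z → eval P z ≈ 0# → eval Q z ≈ 0#
    Q-root {z} a≉z Pz≈0 with zero-divisor (trans (sym (trans (+-congˡ r≈0) (+-identityʳ _))) (trans (sym (divide-correct P a z)) Pz≈0))
    ... | inj₁ z-a≈0 = ⊥-elim (a≉z (sym (begin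
      z                 ≈⟨ solve 2 (λ z a → z := (z :+ :- a) :+ a) refl z a ⟩
      (z + - a) + a     ≈⟨ +-congʳ z-a≈0 ⟩
      0# + a            ≈⟨ +-identityˡ a ⟩
      a                 ∎)))
    ... | inj₂ Qz≈0 = Qz≈0

  Xⁿ : ∀ n → Monic n
  Xⁿ zero    = 1ₘ
  Xⁿ (suc n) = 0# ∷ₘ Xⁿ n

  eval-Xⁿ : ∀ n z → eval (Xⁿ n) z ≈ z ^ n
  eval-Xⁿ zero    z = refl
  eval-Xⁿ (suc n) z = trans (+-identityʳ _) (*-congˡ (eval-Xⁿ n z))

  X^[2+n]-X : ∀ n → Monic (suc (suc n))
  X^[2+n]-X n = 0# ∷ₘ ((- 1#) ∷ₘ Xⁿ n)

  X^[2+n]-X-root : ∀ n z → z ^ suc (suc n) ≈ z → eval (X^[2+n]-X n) z ≈ 0#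
  X^[2+n]-X-root n z z^[2+n]≈z = begin
    z * (z * eval (Xⁿ n) z + - 1#) + 0#    ≈⟨ +-identityʳ _ ⟩
    z * (z * eval (Xⁿ n) z + - 1#)         ≈⟨ *-congˡ (+-congʳ (*-congˡ (eval-Xⁿ n z))) ⟩
    z * (z * z ^ n + - 1#)                 ≈⟨ solve 3 (λ z Z u → z :* (z :* Z :+ :- u) := z :* (z :* Z) :+ :- (z :* u))
                                                    refl z (z ^ n) 1# ⟩
    z * (z * z ^ n) + - (z * 1#)           ≈⟨ +-cong z^[2+n]≈z (-‿cong (*-identityʳ z)) ⟩
    z + - z                                ≈⟨ -‿inverseʳ z ⟩
    0#                                     ∎

  -- If g ≥ 2 divides q - 1 then z ↦ z^g is not injective: its q values
  -- would be distinct roots of X^(H+1) - X, where q - 1 = H·g, yet H + 1 < q.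
  power-not-injective : ∀ g H → 2 ≤ g → 1 ≤ H → q ∸ 1 ≡ H ℕ.* g → ¬ Injective _≈_ _≈_ (_^ g)
  power-not-injective g@(suc g′) H@(suc h) 2≤g 1≤H q∸1≡H*g ^g-injective =
    1+H*g≰1+H H g 1≤H 2≤g (≡.subst (_≤ suc H) q≡1+H*g q≤H+1)
    where
    q≡1+H*g : q ≡ suc (H ℕ.* g)
    q≡1+H*g = ≡.trans (≡.sym (ℕ.suc-pred q {{q≢0}})) (≡.cong suc q∸1≡H*g)
    values : Fin q → Carrier
    values i = to i ^ g
    distinct : ∀ {i j} → ¬ (i ≡ j) → values i ≉ values j
    distinct {i} {j} i≢j vi≈vj = i≢j (≡.trans (≡.sym (strictlyInverseʳ i))
                                        (≡.trans (from-cong (^g-injective vi≈vj)) (strictlyInverseʳ j)))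
    root : ∀ z → (z ^ g) ^ suc H ≈ z ^ g
    root z = begin
      (z ^ g) ^ suc H        ≈⟨ ^-assocʳ z g (suc H) ⟩
      z ^ (g ℕ.* suc H)      ≡⟨ ≡.cong (z ^_) (≡.trans (exponent-shift g′ H) (≡.cong (g′ ℕ.+_) (≡.sym q≡1+H*g))) ⟩
      z ^ (g′ ℕ.+ q)         ≈⟨ ^-homo-* z g′ q ⟩
      z ^ g′ * z ^ q         ≈⟨ *-congˡ (fermat z) ⟩
      z ^ g′ * z             ≈⟨ *-comm _ _ ⟩
      z ^ g                  ∎
    q≤H+1 : q ≤ suc H
    q≤H+1 = ≡.subst (_≤ suc H) (List.length-tabulate values)
      (root-bound (X^[2+n]-X h) (tabulate values)
        (AllPairs.tabulate⁺ distinct)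
        (All.tabulate⁺ (λ i → X^[2+n]-X-root h (values i) (root (to i)))))

  power-injective-divisor : ∀ {m g} r → m ≡ r ℕ.* g → Injective _≈_ _≈_ (_^ m) → Injective _≈_ _≈_ (_^ g)
  power-injective-divisor {m} {g} r m≡r*g ^m-injective {z₁} {z₂} z₁^g≈z₂^g = ^m-injective (begin
    z₁ ^ m          ≈⟨ ^m≈^g^r z₁ ⟩
    (z₁ ^ g) ^ r    ≈⟨ ^-congˡ r z₁^g≈z₂^g ⟩
    (z₂ ^ g) ^ r    ≈⟨ ^m≈^g^r z₂ ⟨
    z₂ ^ m          ∎)
    where
    ^m≈^g^r : ∀ z → z ^ m ≈ (z ^ g) ^ r
    ^m≈^g^r z = sym (trans (^-assocʳ z g r) (reflexive (≡.cong (z ^_) (≡.trans (ℕ.*-comm g r) (≡.sym m≡r*g)))))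

  -- Bézout gives a·m ≡ 1 (mod q - 1), so z ↦ z^a inverts z ↦ z^m.
  coprime⇒power-bijective : ∀ m → 2 ≤ q ∸ 1 → gcd m (q ∸ 1) ≡ 1 → Bijective _≈_ _≈_ (_^ m)
  coprime⇒power-bijective m 2≤q∸1 gcd≡1 with bezout-inverse m (q ∸ 1) gcd≡1 2≤q∸1
  ... | a , t , a*m≡1+t[q-1] = FunctionConsequences.inverseᵇ⇒bijective setoid setoid (inverseˡ , inverseʳ)
    where
    power-power : ∀ z → (z ^ a) ^ m ≈ z
    power-power z = trans (^-assocʳ z a m) (trans (reflexive (≡.cong (z ^_) a*m≡1+t[q-1])) (fermat-iterate t z))
    power-power′ : ∀ z → (z ^ m) ^ a ≈ z
    power-power′ z = trans (^-assocʳ z m a)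
      (trans (reflexive (≡.cong (z ^_) (≡.trans (ℕ.*-comm m a) a*m≡1+t[q-1]))) (fermat-iterate t z))
    inverseˡ : ∀ {x y} → y ≈ x ^ a → y ^ m ≈ x
    inverseˡ {x} y≈ = trans (^-congˡ m y≈) (power-power x)
    inverseʳ : ∀ {x y} → y ≈ x ^ m → y ^ a ≈ x
    inverseʳ {x} y≈ = trans (^-congˡ a y≈) (power-power′ x)

  -- A common divisor g ≥ 2 of m and q - 1 would make z ↦ z^g injective.
  power-injective⇒coprime : ∀ m → 2 ≤ q ∸ 1 → Injective _≈_ _≈_ (_^ m) → gcd m (q ∸ 1) ≡ 1
  power-injective⇒coprime m 2≤q∸1 ^m-injective
    with gcd m (q ∸ 1) in gcd≡g | gcd[m,n]∣m m (q ∸ 1) | gcd[m,n]∣n m (q ∸ 1)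
  ... | zero            | _ | _ = ⊥-elim (q∸1≢0 (gcd[m,n]≡0⇒n≡0 m gcd≡g))
    where
    q∸1≢0 : ¬ (q ∸ 1 ≡ 0)
    q∸1≢0 q∸1≡0 with ≡.subst (2 ≤_) q∸1≡0 2≤q∸1
    ... | ()
  ... | suc zero        | _ | _ = ≡.refl
  ... | g@(suc (suc _)) | divides r m≡r*g | divides H q∸1≡H*g =
    ⊥-elim (power-not-injective g H (s≤s (s≤s z≤n)) 1≤H q∸1≡H*g (power-injective-divisor r m≡r*g ^m-injective))
    where
    positive : ∀ H → 2 ≤ H ℕ.* g → 1 ≤ H
    positive (suc _) _ = s≤s z≤n
    1≤H : 1 ≤ H
    1≤H = positive H (≡.subst (2 ≤_) q∸1≡H*g 2≤q∸1)

  power-bijective⇔coprime : ∀ m → 2 ≤ q ∸ 1 → Bijective _≈_ _≈_ (_^ m) ⇔ (gcd m (q ∸ 1) ≡ 1)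
  power-bijective⇔coprime m 2≤q∸1 =
    mk⇔ (λ (injective , _) → power-injective⇒coprime m 2≤q∸1 injective) (coprime⇒power-bijective m 2≤q∸1)

module FiniteSums {c ℓ} (R : CommutativeRing c ℓ) where
  open import Data.Nat using (zero; suc; _≤_; s≤s; z≤n)
  open CommutativeRing R
  open import Algebra.Properties.CommutativeSemigroup +-commutativeSemigroup using (interchange)

  Σ< : ℕ → (ℕ → Carrier) → Carrier
  Σ< zero    f = 0#
  Σ< (suc N) f = f 0 + Σ< N (λ i → f (suc i))

  Σ<-cong : ∀ N {f g : ℕ → Carrier} → (∀ i → f i ≈ g i) → Σ< N f ≈ Σ< N g
  Σ<-cong zero    f≈g = refl
  Σ<-cong (suc N) f≈g = +-cong (f≈g 0) (Σ<-cong N (λ i → f≈g (suc i)))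

  Σ<-+ : ∀ N (f g : ℕ → Carrier) → Σ< N (λ i → f i + g i) ≈ Σ< N f + Σ< N g
  Σ<-+ zero    f g = sym (+-identityʳ 0#)
  Σ<-+ (suc N) f g = trans (+-congˡ (Σ<-+ N _ _)) (interchange (f 0) (g 0) _ _)

  Σ<-*ˡ : ∀ N a (f : ℕ → Carrier) → Σ< N (λ i → a * f i) ≈ a * Σ< N f
  Σ<-*ˡ zero    a f = sym (zeroʳ a)
  Σ<-*ˡ (suc N) a f = trans (+-congˡ (Σ<-*ˡ N a _)) (sym (distribˡ a _ _))

  Σ<-zeros : ∀ N {f : ℕ → Carrier} → (∀ i → f i ≈ 0#) → Σ< N f ≈ 0#
  Σ<-zeros zero    f≈0 = refl
  Σ<-zeros (suc N) f≈0 = trans (+-cong (f≈0 0) (Σ<-zeros N (λ i → f≈0 (suc i)))) (+-identityˡ 0#)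

  Σ<-truncate : ∀ {M N} (f : ℕ → Carrier) → M ≤ N → (∀ i → M ≤ i → f i ≈ 0#) → Σ< N f ≈ Σ< M f
  Σ<-truncate {zero}  {N}     f _         f≈0 = Σ<-zeros N (λ i → f≈0 i z≤n)
  Σ<-truncate {suc M} {suc N} f (s≤s M≤N) f≈0 =
    +-congˡ (Σ<-truncate (λ i → f (suc i)) M≤N (λ i M≤i → f≈0 (suc i) (s≤s M≤i)))

-- The sums E_n = Σ_{i ≤ n/2} C(n - i, i) y^i (with y = -x these are the
-- reversed Dickson polynomials of the second kind) satisfy, by Pascal's
-- rule, the Fibonacci-type recurrence E_{n+2} = E_{n+1} + y·E_n.
module SecondKind {c ℓ} (R : CommutativeRing c ℓ) (y : CommutativeRing.Carrier R) where
  open import Data.Nat as ℕ using (suc; _∸_; _≤_; _/_)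
  import Data.Nat.Properties as ℕ
  open import Data.Nat.Combinatorics using (_C_)
  open Arithmetic using (binomial-vanishes; pascal-shifted; half-range)
  open CommutativeRing R
  open FiniteSums R
  open IntegerCoefficientSolver R using (natR; solve; _:+_; _:*_; _:=_)
  open import Algebra.Properties.Semiring.Exp semiring using (_^_)
  open import Algebra.Properties.Semiring.Mult semiring using (×-homo-+)
  open import Relation.Binary.Reasoning.Setoid setoid

  term : ℕ → ℕ → Carrier
  term n i = natR ((n ∸ i) C i) * y ^ i

  E : ℕ → Carrier
  E n = Σ< (suc (n / 2)) (term n)

  E-range : ∀ n {N} → suc (n / 2) ≤ N → Σ< N (term n) ≈ E n
  E-range n le = Σ<-truncate (term n) le term-vanishes
    where
    term-vanishes : ∀ i → suc (n / 2) ≤ i → term n i ≈ 0#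
    term-vanishes i n/2<i = trans (*-congʳ (reflexive (≡.cong natR (binomial-vanishes n i n/2<i)))) (zeroˡ _)

  term-pascal : ∀ n i → term (suc (suc n)) (suc i) ≈ term (suc n) (suc i) + y * term n i
  term-pascal n i = begin
    natR ((suc n ∸ i) C suc i) * (y * y ^ i)                ≡⟨ ≡.cong (λ k → natR k * (y * y ^ i)) (pascal-shifted n i) ⟩
    natR ((n ∸ i) C suc i ℕ.+ (n ∸ i) C i) * (y * y ^ i)    ≈⟨ *-congʳ (×-homo-+ 1# ((n ∸ i) C suc i) ((n ∸ i) C i)) ⟩
    (natR ((n ∸ i) C suc i) + natR ((n ∸ i) C i)) * (y * y ^ i)
      ≈⟨ solve 4 (λ a b y Y → (a :+ b) :* (y :* Y) := a :* (y :* Y) :+ y :* (b :* Y)) refl _ _ y (y ^ i) ⟩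
    natR ((n ∸ i) C suc i) * (y * y ^ i) + y * (natR ((n ∸ i) C i) * y ^ i) ∎

  -- Over the common range n + 3: split off i = 0, apply Pascal's rule
  -- termwise and recombine.
  E-recurrence : ∀ n → E (suc (suc n)) ≈ E (suc n) + y * E n
  E-recurrence n = begin
    E n₂                                                           ≈⟨ E-range n₂ (half-range n₂) ⟨
    term n₂ 0 + Σ< n₂ (λ i → term n₂ (suc i))                      ≈⟨ +-congˡ (Σ<-cong n₂ (term-pascal n)) ⟩
    term n₁ 0 + Σ< n₂ (λ i → term n₁ (suc i) + y * term n i)       ≈⟨ +-congˡ (Σ<-+ n₂ (λ i → term n₁ (suc i)) (λ i → y * term n i)) ⟩
    term n₁ 0 + (Σ< n₂ (λ i → term n₁ (suc i)) + Σ< n₂ (λ i → y * term n i))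
                                                                   ≈⟨ +-congˡ (+-congˡ (Σ<-*ˡ n₂ y (term n))) ⟩
    term n₁ 0 + (Σ< n₂ (λ i → term n₁ (suc i)) + y * Σ< n₂ (term n))
                                                                   ≈⟨ +-assoc _ _ _ ⟨
    Σ< (suc n₂) (term n₁) + y * Σ< n₂ (term n)                     ≈⟨ +-cong (E-range n₁ (ℕ.m≤n⇒m≤1+n (half-range n₁)))
                                                                             (*-congˡ (E-range n (ℕ.m≤n⇒m≤1+n (half-range n)))) ⟩
    E n₁ + y * E n                                                 ∎
    where
    n₁ n₂ : ℕ
    n₁ = suc n
    n₂ = suc (suc n)

module ThirdKind {q c ℓ} (K : FiniteField q c ℓ) (x : FiniteField.Carrier K) where
  open import Data.Nat as ℕ using (zero; suc; _∸_; _/_)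
  open import Data.Nat.Combinatorics using (_C_)
  open import Data.Integer as ℤ using (+_; -[1+_])
  open import Data.List using (map; applyUpTo)
  open Arithmetic using (∸-suc-∸-1; [2+k]/2)
  open FiniteField K hiding (zero)
  open FiniteSums commRing
  open SecondKind commRing (- x)
  open IntegerCoefficientSolver commRing using (natR; intR; intR-+; intR-neg; solve; _:+_; _:*_; :-_; _:=_)
  open import Algebra.Properties.Semiring.Exp semiring using (_^_)
  open import Relation.Binary.Reasoning.Setoid setoid

  natK≡natR : ∀ n → natK K n ≡ natR n
  natK≡natR zero    = ≡.refl
  natK≡natR (suc n) = ≡.cong (λ t → 1# + t) (natK≡natR n)

  intK≡intR : ∀ i → intK K i ≡ intR i
  intK≡intR (+ n)    = natK≡natR n
  intK≡intR -[1+ n ] = ≡.cong -_ (natK≡natR (suc n))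

  pow≡^ : ∀ z n → pow K z n ≡ z ^ n
  pow≡^ z zero    = ≡.refl
  pow≡^ z (suc n) = ≡.cong (z *_) (pow≡^ z n)

  sumK-applyUpTo : ∀ N (f : ℕ → Carrier) g → sumK K (map f (applyUpTo g N)) ≡ Σ< N (λ i → f (g i))
  sumK-applyUpTo zero    f g = ≡.refl
  sumK-applyUpTo (suc N) f g = ≡.cong (λ t → f (g 0) + t) (sumK-applyUpTo N f (λ i → g (suc i)))

  F : ℕ → Carrier
  F n = reversedDickson3 K n 1# x

  coefficient : ℕ → ℕ → Carrier
  coefficient n i = intR (dicksonCoeff n i)

  F-sum : ∀ n → F n ≈ Σ< (suc (n / 2)) (λ i → coefficient n i * (- x) ^ i)
  F-sum n = trans (reflexive (sumK-applyUpTo (suc (n / 2)) _ (λ i → i))) (Σ<-cong (suc (n / 2)) bridge)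
    where
    1#^ : ∀ k → 1# ^ k ≈ 1#
    1#^ zero    = refl
    1#^ (suc k) = trans (*-identityˡ _) (1#^ k)
    bridge : ∀ i → intK K (dicksonCoeff n i) * pow K (- x) i * pow K 1# (n ∸ 2 ℕ.* i) ≈ coefficient n i * (- x) ^ i
    bridge i = begin
      intK K (dicksonCoeff n i) * pow K (- x) i * pow K 1# (n ∸ 2 ℕ.* i)
        ≡⟨ ≡.cong₂ (λ a b → a * b * pow K 1# (n ∸ 2 ℕ.* i)) (intK≡intR (dicksonCoeff n i)) (pow≡^ (- x) i) ⟩
      coefficient n i * (- x) ^ i * pow K 1# (n ∸ 2 ℕ.* i)
        ≈⟨ *-congˡ (trans (reflexive (pow≡^ 1# (n ∸ 2 ℕ.* i))) (1#^ (n ∸ 2 ℕ.* i))) ⟩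
      coefficient n i * (- x) ^ i * 1#
        ≈⟨ *-identityʳ _ ⟩
      coefficient n i * (- x) ^ i ∎

  -- (n-2i)/(n-i)·C(n-i,i) = C(n-i,i) - C(n-i-1,i-1) splits the i-th term.
  term-split : ∀ n j → coefficient n (suc j) * (- x) ^ suc j ≈ term n (suc j) + x * term (n ∸ 2) j
  term-split n j = begin
    intR (+ A ℤ.+ ℤ.- + B) * (- x * (- x) ^ j)           ≈⟨ *-congʳ (trans (intR-+ (+ A) (ℤ.- + B)) (+-congˡ (intR-neg (+ B)))) ⟩
    (natR A + - natR B) * (- x * (- x) ^ j)              ≈⟨ solve 4 (λ a b x Y → (a :+ :- b) :* (:- x :* Y) := a :* (:- x :* Y) :+ x :* (b :* Y))
                                                                  refl (natR A) (natR B) x ((- x) ^ j) ⟩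
    natR A * (- x * (- x) ^ j) + x * (natR B * (- x) ^ j) ≡⟨ ≡.cong (λ k → natR A * (- x * (- x) ^ j) + x * (natR (k C j) * (- x) ^ j))
                                                                   (∸-suc-∸-1 n j) ⟩
    term n (suc j) + x * term (n ∸ 2) j                  ∎
    where
    A B : ℕ
    A = (n ∸ suc j) C suc j
    B = (n ∸ suc j ∸ 1) C j

  F≈E+xE : ∀ k → F (suc (suc k)) ≈ E (suc (suc k)) + x * E k
  F≈E+xE k = begin
    F n                                                                   ≈⟨ F-sum n ⟩
    term n 0 + Σ< (n / 2) (λ j → coefficient n (suc j) * (- x) ^ suc j)   ≈⟨ +-congˡ (Σ<-cong (n / 2) (term-split n)) ⟩
    term n 0 + Σ< (n / 2) (λ j → term n (suc j) + x * term k j)           ≈⟨ +-congˡ (Σ<-+ (n / 2) (λ j → term n (suc j)) (λ j → x * term k j)) ⟩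
    term n 0 + (Σ< (n / 2) (λ j → term n (suc j)) + Σ< (n / 2) (λ j → x * term k j))
                                                                          ≈⟨ +-congˡ (+-congˡ (Σ<-*ˡ (n / 2) x (term k))) ⟩
    term n 0 + (Σ< (n / 2) (λ j → term n (suc j)) + x * Σ< (n / 2) (term k))
                                                                          ≈⟨ +-assoc _ _ _ ⟨
    E n + x * Σ< (n / 2) (term k)                                         ≡⟨ ≡.cong (λ N → E n + x * Σ< N (term k)) ([2+k]/2 k) ⟩
    E n + x * E k                                                         ∎
    where n = suc (suc k)

-- Lucas sequences in R[√D] with D = 1 - 4x: writing (1 + √D)^n = a_n + b_n√D,
-- the coefficients b_n satisfy b_{n+2} = 2·b_{n+1} - 4x·b_n, which ties them to
-- the second-kind sums E with y = -x: 2·b_{n+1} = 2^(n+1)·E_n.  In prime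
-- characteristic p the Frobenius map computes b_{p^k} = D^((p^k - 1)/2).
module LucasSequence {c ℓ} (R : CommutativeRing c ℓ) (x : CommutativeRing.Carrier R) where
  open import Data.Nat as ℕ using (zero; suc)
  import Data.Nat.Properties as ℕ
  open import Data.Nat.Primality using (Prime)
  open import Data.Integer using (+_)
  open import Data.Product using (_,_; proj₁; proj₂)
  open CommutativeRing R
  open IntegerCoefficientSolver R using (natR; solve; _:+_; _:*_; :-_; _:=_; con)
  open import Algebra.Properties.Semiring.Exp semiring using (_^_)
  open import Relation.Binary.Reasoning.Setoid setoid
  open SecondKind R (- x) using (E; E-recurrence)

  one two four : Carrier
  one  = natR 1
  two  = natR 2
  four = two * two

  D : Carrier
  D = one + - (four * x)

  open QuadraticExtension R D using (R[√D])
  private module Ext = CommutativeRing R[√D]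
  open import Algebra.Properties.Semiring.Exp Ext.semiring using () renaming (_^_ to _^ₑ_; ^-congˡ to ^ₑ-congˡ)
  open import Algebra.Properties.Semiring.Mult Ext.semiring using () renaming (_×_ to _×ₑ_)

  -- α = 1 + √D, with 1 written as natR 1 so that the solver sees a constant
  α : Ext.Carrier
  α = (one , one)

  b : ℕ → Carrier
  b n = proj₂ (α ^ₑ n)

  -- From α^(n+1) = α·α^n: b_{n+2} = 2·b_{n+1} + (D - 1)·b_n.
  b-recurrence : ∀ n → b (suc (suc n)) ≈ two * b (suc n) + - (four * x * b n)
  b-recurrence n = solve 3
    (λ a b x → con (+ 1) :* (con (+ 1) :* b :+ con (+ 1) :* a)
               :+ con (+ 1) :* (con (+ 1) :* a :+ (con (+ 1) :+ :- ((con (+ 2) :* con (+ 2)) :* x)) :* (con (+ 1) :* b))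
             := con (+ 2) :* (con (+ 1) :* b :+ con (+ 1) :* a) :+ :- ((con (+ 2) :* con (+ 2)) :* x :* b))
    refl (proj₁ (α ^ₑ n)) (b n) x

  -- 2·b_{n+1} = 2^(n+1)·E_n, by the common recurrence.
  b≈E : ∀ n → two * b (suc n) ≈ two ^ suc n * E n
  b≈E zero = begin
    two * b 1          ≈⟨ *-congˡ (proj₂ (Ext.*-identityʳ α)) ⟩
    two * one          ≈⟨ *-cong (*-identityʳ two) E₀≈1 ⟨
    two ^ 1 * E 0      ∎
    where
    E₀≈1 : E 0 ≈ one
    E₀≈1 = trans (+-identityʳ _) (*-identityʳ one)
  b≈E (suc zero) = begin
    two * b 2                     ≈⟨ *-congˡ (proj₂ (Ext.*-congˡ {α} (Ext.*-identityʳ α))) ⟩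
    two * (one * one + one * one) ≈⟨ solve 0 (con (+ 2) :* (con (+ 1) :* con (+ 1) :+ con (+ 1) :* con (+ 1))
                                             := (con (+ 2) :* con (+ 2)) :* con (+ 1)) refl ⟩
    (two * two) * one             ≈⟨ *-cong (*-congˡ (*-identityʳ two)) E₁≈1 ⟨
    two ^ 2 * E 1                 ∎
    where
    E₁≈1 : E 1 ≈ one
    E₁≈1 = trans (+-identityʳ _) (*-identityʳ one)
  b≈E (suc (suc n)) = begin
    two * b (3 ℕ.+ n)                                                 ≈⟨ *-congˡ (b-recurrence (suc n)) ⟩
    two * (two * b (2 ℕ.+ n) + - (four * x * b (suc n)))              ≈⟨ solve 4 (λ t x b₂ b₁ → t :* (t :* b₂ :+ :- ((t :* t) :* x :* b₁))
                                                                                   := t :* (t :* b₂) :+ :- ((t :* t) :* x :* (t :* b₁)))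
                                                                               refl two x (b (2 ℕ.+ n)) (b (suc n)) ⟩
    two * (two * b (2 ℕ.+ n)) + - (four * x * (two * b (suc n)))      ≈⟨ +-cong (*-congˡ (b≈E (suc n))) (-‿cong (*-congˡ (b≈E n))) ⟩
    two * (two ^ (2 ℕ.+ n) * E (suc n)) + - (four * x * (two ^ suc n * E n))
                                                                      ≈⟨ solve 5 (λ t T x e₁ e₀ → t :* ((t :* T) :* e₁) :+ :- ((t :* t) :* x :* (T :* e₀))
                                                                                      := (t :* (t :* T)) :* (e₁ :+ :- x :* e₀))
                                                                               refl two (two ^ suc n) x (E (suc n)) (E n) ⟩
    two ^ (3 ℕ.+ n) * (E (suc n) + - x * E n)                         ≈⟨ *-congˡ (E-recurrence n) ⟨
    two ^ (3 ℕ.+ n) * E (2 ℕ.+ n)                                     ∎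

  √D : Ext.Carrier
  √D = (0# , one)

  α≈1+√D : α Ext.≈ Ext.1# Ext.+ √D
  α≈1+√D = refl , sym (+-identityˡ one)

  √D^odd : ∀ m → √D ^ₑ suc (m ℕ.+ m) Ext.≈ (0# , D ^ m)
  √D^odd zero =
      trans (+-cong (zeroˡ 1#) (trans (*-congˡ (zeroʳ one)) (zeroʳ D))) (+-identityʳ 0#)
    , trans (+-cong (zeroˡ 0#) (*-identityʳ one)) (trans (+-identityˡ one) (+-identityʳ 1#))
  √D^odd (suc m) = Ext.trans (Ext.reflexive (≡.cong (λ e → √D ^ₑ suc e) (ℕ.+-suc (suc m) m)))
                             (Ext.trans (Ext.*-congˡ (Ext.*-congˡ (√D^odd m))) (first , second))
    where
    first : 0# * (0# * 0# + D * (one * D ^ m)) + D * (one * (0# * D ^ m + one * 0#)) ≈ 0#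
    first = solve 2 (λ d D → con (+ 0) :* (con (+ 0) :* con (+ 0) :+ D :* (con (+ 1) :* d))
                             :+ D :* (con (+ 1) :* (con (+ 0) :* d :+ con (+ 1) :* con (+ 0))) := con (+ 0)) refl (D ^ m) D
    second : 0# * (0# * D ^ m + one * 0#) + one * (0# * 0# + D * (one * D ^ m)) ≈ D * D ^ m
    second = solve 2 (λ d D → con (+ 0) :* (con (+ 0) :* d :+ con (+ 1) :* con (+ 0))
                              :+ con (+ 1) :* (con (+ 0) :* con (+ 0) :+ D :* (con (+ 1) :* d)) := D :* d) refl (D ^ m) D

  extension-characteristic : ∀ {p} → natR p ≈ 0# → p ×ₑ Ext.1# Ext.≈ Ext.0#
  extension-characteristic {p} char = Ext.trans (multiple p) (char , refl)
    where
    multiple : ∀ n → n ×ₑ Ext.1# Ext.≈ (natR n , 0#)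
    multiple zero    = refl , refl
    multiple (suc n) = +-congˡ (proj₁ (multiple n)) , trans (+-congˡ (proj₂ (multiple n))) (+-identityʳ 0#)

  -- In characteristic p: (1 + √D)^(p^k) = 1 + √D^(p^k) = 1 + D^m·√D when
  -- p^k = 2m + 1, so b_{p^k} = D^m.
  b-frobenius : ∀ {p} → Prime p → natR p ≈ 0# → ∀ k m → p ℕ.^ k ≡ suc (m ℕ.+ m) → b (p ℕ.^ k) ≈ D ^ m
  b-frobenius {p} pp char k m p^k≡2m+1 = trans (proj₂ α^p^k≈1+D^m√D) (+-identityˡ _)
    where
    open Frobenius R[√D] using (frobenius-iterate-additive; 1#^)
    α^p^k≈1+D^m√D : α ^ₑ (p ℕ.^ k) Ext.≈ Ext.1# Ext.+ (0# , D ^ m)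
    α^p^k≈1+D^m√D = Ext.trans (^ₑ-congˡ (p ℕ.^ k) α≈1+√D)
                   (Ext.trans (frobenius-iterate-additive pp (extension-characteristic {p} char) k Ext.1# √D)
                              (Ext.+-cong (1#^ (p ℕ.^ k))
                                          (≡.subst (λ e → √D ^ₑ e Ext.≈ (0# , D ^ m)) (≡.sym p^k≡2m+1) (√D^odd m))))

module BijectionTransfer {a ℓ} (S : Setoid a ℓ) where
  open import Data.Product using (_,_; proj₁; proj₂)
  open import Function.Bundles using (_⇔_; mk⇔)
  open import Function.Definitions using (Bijective; Congruent)
  import Function.Construct.Composition as Composition
  import Function.Consequences.Setoid as FunctionConsequences
  open Setoid S

  bijective-resp-≈ : ∀ {f g : Carrier → Carrier} → (∀ x → f x ≈ g x) → Bijective _≈_ _≈_ f → Bijective _≈_ _≈_ g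
  bijective-resp-≈ f≈g (f-injective , f-surjective) =
      (λ gx≈gy → f-injective (trans (f≈g _) (trans gx≈gy (sym (f≈g _)))))
    , (λ y → proj₁ (f-surjective y) , λ z≈x → trans (sym (f≈g _)) (proj₂ (f-surjective y) z≈x))

  bijective-precompose⇔ : ∀ {f g : Carrier → Carrier} (h h⁻¹ : Carrier → Carrier) →
    Congruent _≈_ _≈_ g → Congruent _≈_ _≈_ h → Congruent _≈_ _≈_ h⁻¹ →
    (∀ y → h (h⁻¹ y) ≈ y) → (∀ x → h⁻¹ (h x) ≈ x) →
    (∀ x → f x ≈ g (h x)) → Bijective _≈_ _≈_ f ⇔ Bijective _≈_ _≈_ g
  bijective-precompose⇔ {f} {g} h h⁻¹ g-cong h-cong h⁻¹-cong hh⁻¹ h⁻¹h f≈g∘h = mk⇔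
    (λ f-bijective → bijective-resp-≈ (λ y → trans (f≈g∘h (h⁻¹ y)) (g-cong (hh⁻¹ y)))
                       (Composition.bijective _≈_ _≈_ _≈_ h⁻¹-bijective f-bijective))
    (λ g-bijective → bijective-resp-≈ (λ x → sym (f≈g∘h x))
                       (Composition.bijective _≈_ _≈_ _≈_ h-bijective g-bijective))
    where
    h-bijective : Bijective _≈_ _≈_ h
    h-bijective = FunctionConsequences.inverseᵇ⇒bijective S S
      ((λ y≈h⁻¹x → trans (h-cong y≈h⁻¹x) (hh⁻¹ _)) , (λ y≈hx → trans (h⁻¹-cong y≈hx) (h⁻¹h _)))
    h⁻¹-bijective : Bijective _≈_ _≈_ h⁻¹
    h⁻¹-bijective = FunctionConsequences.inverseᵇ⇒bijective S S
      ((λ y≈hx → trans (h⁻¹-cong y≈hx) (h⁻¹h _)) , (λ y≈h⁻¹x → trans (h-cong y≈h⁻¹x) (hh⁻¹ _)))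

module DicksonAtPrimePowers {q c ℓ} (K : FiniteField q c ℓ) where
  open import Data.Nat as ℕ using (suc; _∸_; _/_; _%_; _≤_)
  import Data.Nat.Properties as ℕ
  open import Data.Nat.Primality using (Prime)
  open import Function.Bundles using (_⇔_)
  open import Function.Definitions using (Bijective)
  open Arithmetic using (odd-split; odd-^; 2≤odd-prime^e∸1)
  open FiniteField K hiding (zero)
  open FiniteFieldFacts K
  open IntegerCoefficientSolver commRing using (natR; solve; _:+_; _:*_; :-_; _:=_)
  open import Algebra.Properties.Semiring.Exp semiring using (_^_; ^-congˡ)
  open import Relation.Binary.Reasoning.Setoid setoid
  open LucasSequence commRing using (D; b; b≈E; b-recurrence; b-frobenius)

  one two four : Carrier
  one  = natR 1
  two  = natR 2
  four = two * two

  -- 2^(j+3)·F_{j+2}(1, x) = 4·b_{j+2}: combine F_{j+2} = E_{j+2} + x·E_j,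
  -- 2·b_{n+1} = 2^(n+1)·E_n and the recurrence for b.
  F-lucas : ∀ x j → two ^ (3 ℕ.+ j) * ThirdKind.F K x (2 ℕ.+ j) ≈ two * (two * b x (2 ℕ.+ j))
  F-lucas x j = begin
    two ^ (3 ℕ.+ j) * F (2 ℕ.+ j)                                   ≈⟨ *-congˡ (F≈E+xE j) ⟩
    two * (two * T) * (E (2 ℕ.+ j) + x * E j)                        ≈⟨ solve 5 (λ t T e₂ e₀ x → t :* (t :* T) :* (e₂ :+ x :* e₀)
                                                                                      := t :* (t :* T) :* e₂ :+ (t :* t) :* x :* (T :* e₀))
                                                                               refl two T (E (2 ℕ.+ j)) (E j) x ⟩
    two ^ (3 ℕ.+ j) * E (2 ℕ.+ j) + four * x * (T * E j)             ≈⟨ +-cong (b≈E x (2 ℕ.+ j)) (*-congˡ (b≈E x j)) ⟨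
    two * b x (3 ℕ.+ j) + four * x * (two * b x (suc j))             ≈⟨ +-congʳ (*-congˡ (b-recurrence x (suc j))) ⟩
    two * (two * b x (2 ℕ.+ j) + - (four * x * b x (suc j))) + four * x * (two * b x (suc j))
                                                                     ≈⟨ solve 4 (λ t x b₂ b₁ → t :* (t :* b₂ :+ :- ((t :* t) :* x :* b₁)) :+ (t :* t) :* x :* (t :* b₁)
                                                                                      := t :* (t :* b₂))
                                                                               refl two x (b x (2 ℕ.+ j)) (b x (suc j)) ⟩
    two * (two * b x (2 ℕ.+ j))                                      ∎
    where
    open ThirdKind K x using (F; F≈E+xE)
    open SecondKind commRing (- x) using (E)
    T : Carrier
    T = two ^ suc j

  module _ {p} (pp : Prime p) (p-odd : p % 2 ≡ 1) (char : natR p ≈ 0#) where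
    open Frobenius commRing using (frobenius-iterate-additive; 1#^)

    four≉0 : four ≉ 0#
    four≉0 = *-≉0 (two≉0 p char p-odd) (two≉0 p char p-odd)

    -- 2^(p^k) = (1 + 1)^(p^k) = 1 + 1
    two^p^k≈two : ∀ k → two ^ (p ℕ.^ k) ≈ two
    two^p^k≈two k = trans (frobenius-iterate-additive pp char k 1# one) (+-cong (1#^ n) one^n)
      where
      n : ℕ
      n = p ℕ.^ k
      one^n : one ^ n ≈ one
      one^n = trans (^-congˡ n (+-identityʳ 1#)) (trans (1#^ n) (sym (+-identityʳ 1#)))

    dickson-at-prime-power : ∀ k → 1 ≤ k → ∀ x → reversedDickson3 K (p ℕ.^ k) 1# x ≈ D x ^ ((p ℕ.^ k ∸ 1) / 2)
    dickson-at-prime-power k 1≤k x = ≡.subst (λ n → F n ≈ D x ^ m) (≡.sym n≡2+j) (*-cancelˡ four four≉0 (begin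
      four * F (2 ℕ.+ j)                     ≈⟨ *-congʳ (*-congˡ (≡.subst (λ e → two ^ e ≈ two) n≡2+j (two^p^k≈two k))) ⟨
      two ^ (3 ℕ.+ j) * F (2 ℕ.+ j)          ≈⟨ F-lucas x j ⟩
      two * (two * b x (2 ℕ.+ j))            ≈⟨ *-congˡ (*-congˡ (≡.subst (λ e → b x e ≈ D x ^ m) n≡2+j
                                                                   (b-frobenius x pp char k m n≡2m+1))) ⟩
      two * (two * D x ^ m)                  ≈⟨ *-assoc two two _ ⟨
      four * D x ^ m                         ∎))
      where
      open ThirdKind K x using (F)
      n m : ℕ
      n = p ℕ.^ k
      m = (n ∸ 1) / 2
      n≡2m+1 : n ≡ suc (m ℕ.+ m)
      n≡2m+1 = odd-split n (odd-^ p k p-odd)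
      2≤n : 2 ≤ n
      2≤n = ℕ.≤-trans (2≤odd-prime^e∸1 k pp p-odd 1≤k) (ℕ.m∸n≤m n 1)
      j : ℕ
      j = n ∸ 2
      n≡2+j : n ≡ 2 ℕ.+ j
      n≡2+j = ≡.sym (ℕ.m+[n∸m]≡n 2≤n)

    ¼ : Carrier
    ¼ = four ⁻¹⟨ four≉0 ⟩

    D⁻¹ : Carrier → Carrier
    D⁻¹ w = (one + - w) * ¼

    D-cong : ∀ {x y} → x ≈ y → D x ≈ D y
    D-cong x≈y = +-congˡ (-‿cong (*-congˡ x≈y))

    D⁻¹-cong : ∀ {x y} → x ≈ y → D⁻¹ x ≈ D⁻¹ y
    D⁻¹-cong x≈y = *-congʳ (+-congˡ (-‿cong x≈y))

    D∘D⁻¹ : ∀ w → D (D⁻¹ w) ≈ w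
    D∘D⁻¹ w = begin
      one + - (four * ((one + - w) * ¼))     ≈⟨ +-congˡ (-‿cong (solve 3 (λ f a i → f :* (a :* i) := a :* (f :* i)) refl four (one + - w) ¼)) ⟩
      one + - ((one + - w) * (four * ¼))     ≈⟨ +-congˡ (-‿cong (trans (*-congˡ (*-inverseʳ four four≉0)) (*-identityʳ _))) ⟩
      one + - (one + - w)                    ≈⟨ solve 2 (λ u w → u :+ :- (u :+ :- w) := w) refl one w ⟩
      w                                      ∎

    D⁻¹∘D : ∀ x → D⁻¹ (D x) ≈ x
    D⁻¹∘D x = begin
      (one + - (one + - (four * x))) * ¼     ≈⟨ solve 4 (λ u f x i → (u :+ :- (u :+ :- (f :* x))) :* i := x :* (f :* i)) refl one four x ¼ ⟩
      x * (four * ¼)                         ≈⟨ *-congˡ (*-inverseʳ four four≉0) ⟩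
      x * 1#                                 ≈⟨ *-identityʳ x ⟩
      x                                      ∎

    dickson-bijective⇔power-bijective : ∀ k → 1 ≤ k →
      IsPermutationPolynomial K (λ x → reversedDickson3 K (p ℕ.^ k) 1# x) ⇔ Bijective _≈_ _≈_ (_^ ((p ℕ.^ k ∸ 1) / 2))
    dickson-bijective⇔power-bijective k 1≤k =
      BijectionTransfer.bijective-precompose⇔ setoid D D⁻¹ (^-congˡ ((p ℕ.^ k ∸ 1) / 2)) D-cong D⁻¹-cong D∘D⁻¹ D⁻¹∘D
        (dickson-at-prime-power k 1≤k)

open import Level using (Level)
open import Data.Nat using (ℕ; _^_; _∸_; _/_; _%_; _≤_)
open import Data.Nat.GCD using (gcd)
open import Data.Nat.Primality using (Prime)
open import Relation.Binary.PropositionalEquality using (_≡_)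
open import Function.Bundles using (_⇔_)
import Function.Properties.Equivalence as Equivalence
open Arithmetic using (2≤odd-prime^e∸1)

-- Theorem 2.6: for an odd prime p, q = p^e and 1 ≤ k ≤ e, F_{p^k}(1, x) is a
-- permutation polynomial of 𝔽_q iff gcd((p^k - 1)/2, q - 1) = 1.  K has
-- characteristic p; F_{p^k}(1, ·) permutes K iff w ↦ w^((p^k-1)/2) does, and
-- the latter is decided by the gcd since q ≥ 3.
theorem2p6 : ∀ {c ℓ : Level} (p e k : ℕ) → Prime p → p % 2 ≡ 1 →
    1 ≤ e → 1 ≤ k → k ≤ e → (K : FiniteField (p ^ e) c ℓ) →
    IsPermutationPolynomial K (λ x → reversedDickson3 K (p ^ k) (FiniteField.1# K) x)
      ⇔ (gcd ((p ^ k ∸ 1) / 2) (p ^ e ∸ 1) ≡ 1)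
theorem2p6 p e k pp p-odd 1≤e 1≤k _ K = Equivalence.trans
  (DicksonAtPrimePowers.dickson-bijective⇔power-bijective K pp p-odd
     (FiniteFieldFacts.characteristic-of-prime-power K p e ≡.refl) k 1≤k)
  (FiniteFieldFacts.power-bijective⇔coprime K ((p ^ k ∸ 1) / 2) (2≤odd-prime^e∸1 e pp p-odd 1≤e))
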